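{- Let $q\ge 27$ be a prime power with $q\equiv 3\pmod 4$, let $\xi$ be a primitive element of $F_q$, and let $J$ be an integer with $(q-3)/4\le J\le (q-3)/2$. Let $\mathcal{C}$ be the conic $x_1^2=x_0x_2$, $\mathcal{D}_J=\{(1,\xi^d,\xi^{2d}): d=0,1,\dots,J\}\subset\mathcal{C}$, $P=(0,1,0)$, $Z=(1,0,-1)$, $B_J=(1,0,-\xi^{2J})$, $\mathcal{E}_J=\mathcal{D}_J\cup\{P,Z,B_J\}$, and let $\ell_1$ be the line $x_1=0$. Then every point of $\ell_1\cup(\mathcal{C}\setminus\mathcal{D}_J)$ lies on a bisecant of $\mathcal{E}_J$.
   Context: Points of $PG(2,q)$ are in homogeneous coordinates $(x_0,x_1,x_2)$. A bisecant of a point set is a line through two of its distinct points. -}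

module Defs where

open import Level using (0ℓ)
open import Data.Nat as ℕ using (ℕ; zero; suc)
open import Data.Nat.Primality using (Prime)
open import Data.Fin using (Fin)
open import Data.Product using (Σ; ∃; ∃-syntax; _×_; _,_)
open import Data.Sum using (_⊎_)
open import Relation.Nullary using (¬_)
open import Relation.Binary.PropositionalEquality using (_≡_; _≢_)
open import Algebra.Structures using (IsCommutativeRing)
open import Function.Bundles using (_↔_)

IsPrimePower : ℕ → Set
IsPrimePower q = Σ ℕ λ p → Σ ℕ λ k → Prime p × q ≡ p ℕ.^ suc k

record FiniteField (q : ℕ) : Set₁ where
  infixl 7 _*_
  infixl 6 _+_
  field
    F     : Set
    _+_   : F → F → F
    _*_   : F → F → F
    -_    : F → F
    0#    : F
    1#    : F
    isCommutativeRing : IsCommutativeRing _≡_ _+_ _*_ -_ 0# 1#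
    0≢1   : 0# ≢ 1#
    inverse : ∀ x → x ≢ 0# → ∃[ y ] (x * y ≡ 1#)
    enumeration : F ↔ Fin q

module _ {q : ℕ} (𝔽 : FiniteField q) where
  open FiniteField 𝔽

  _^_ : F → ℕ → F
  x ^ zero = 1#
  x ^ suc n = x * (x ^ n)

  Primitive : F → Set
  Primitive ξ = ∀ y → y ≢ 0# → ∃[ d ] (ξ ^ d ≡ y)

  -- triples of field elements: homogeneous coordinates (x0,x1,x2)
  record Triple : Set where
    constructor ⟨_,_,_⟩
    field
      c0 c1 c2 : F

  NonZeroT : Triple → Set
  NonZeroT ⟨ a , b , c ⟩ = ¬ (a ≡ 0# × b ≡ 0# × c ≡ 0#)

  scale : F → Triple → Triple
  scale λ' ⟨ a , b , c ⟩ = ⟨ λ' * a , λ' * b , λ' * c ⟩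

  _∼_ : Triple → Triple → Set
  X ∼ Y = ∃[ λ' ] (λ' ≢ 0# × X ≡ scale λ' Y)

  -- incidence of point X with line L = [a0,a1,a2] : a0x0+a1x1+a2x2 = 0
  Incident : Triple → Triple → Set
  Incident ⟨ a , b , c ⟩ ⟨ x , y , z ⟩ = a * x + b * y + c * z ≡ 0#

  -- X lies on a bisecant of the point set S (given as a predicate on coordinates
  -- closed under ∼): some line through two distinct points of S passes through X
  OnBisecant : (Triple → Set) → Triple → Set
  OnBisecant S X =
    ∃[ Y ] ∃[ Y' ] ∃[ L ]
      (S Y × S Y' × ¬ (Y ∼ Y') × NonZeroT L ×
       Incident L Y × Incident L Y' × Incident L X)

  OnConic : Triple → Set
  OnConic ⟨ x , y , z ⟩ = y * y ≡ x * z

  OnL1 : Triple → Set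
  OnL1 ⟨ x , y , z ⟩ = y ≡ 0#

  module _ (ξ : F) (J : ℕ) where
    InD : Triple → Set
    InD X = ∃[ d ] (d ℕ.≤ J × X ∼ ⟨ 1# , ξ ^ d , ξ ^ (2 ℕ.* d) ⟩)

    Pp Zp Bp : Triple
    Pp = ⟨ 0# , 1# , 0# ⟩
    Zp = ⟨ 1# , 0# , - 1# ⟩
    Bp = ⟨ 1# , 0# , - (ξ ^ (2 ℕ.* J)) ⟩

    InE : Triple → Set
    InE X = InD X ⊎ X ∼ Pp ⊎ X ∼ Zp ⊎ X ∼ Bp

module Submission where

-- Write q = 4a + 3 and h = 2a + 1, so that q - 1 = 2h.
--
-- 1. Field arithmetic: decidable equality, cancellation, laws for powers.
-- 2. A primitive element has order exactly q - 1.  A positive period p of ξ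
--    gives q ≤ p + 1, since 0 and ξ^0, …, ξ^(p-1) exhaust F; and by pigeonhole
--    two of ξ^0, …, ξ^(q-1) agree, which yields a period p ≤ q - 1.  Hence
--    ξ^(2h) = 1, while ξ^(2J) ≠ 1 because 0 < 2J < q - 1.
-- 3. Exponent arithmetic: for J < e ≤ 2h (and h ≤ 2J + 1, i.e. J ≥ a) there
--    is d ≤ J with d + e = 2J, or d + e = 2h, or d + h = e.
-- 4. Conic geometry over F, for an arbitrary point set S: the chord through
--    (1,s,s²) and (1,t,t²) meets ℓ1 in (1,0,-st); for s² = t² the line
--    x2 = s² x0 passes through both points and P; and two distinct points of S
--    on ℓ1 make ℓ1 itself a bisecant.
-- 5. Covering: a point of ℓ1 lies on the bisecant Z B_J.  A conic point off ℓ1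
--    is (1,t,t²) up to a scalar, t = ξ^e with e < 2h, and J < e because it is
--    not in D_J; the three exponent cases give, with s = ξ^d ∈ D_J, the chord
--    through B_J (st = ξ^(2J)), through Z (st = 1), or through P (s² = t²).

open import Defs hiding (_^_)
open import Data.Nat as ℕ using (ℕ; zero; suc; _≤_; _<_; _∸_; _%_; z≤n; s≤s)
import Data.Nat.Properties as ℕₚ
open import Data.Nat.DivMod using (_/_; m≡m%n+[m/n]*n; m%n<n)
open import Data.Nat.Tactic.RingSolver using (solve-∀)
open import Data.Fin as Fin using (Fin; toℕ; fromℕ<; punchOut)
import Data.Fin.Properties as Finₚ
open import Data.Product using (∃₂; ∃-syntax; _×_; _,_; proj₁; proj₂)
open import Data.Sum using (_⊎_; inj₁; inj₂)
open import Data.Empty using (⊥-elim)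
open import Relation.Nullary using (¬_; Dec; yes; no)
open import Relation.Nullary.Decidable using (map′)
open import Relation.Binary.PropositionalEquality
open import Function.Bundles using (Inverse; Injection)
open import Function.Properties.Inverse using (Inverse⇒Injection; ↔-sym)
open import Algebra.Bundles using (CommutativeRing)
open import Algebra.Structures using (IsCommutativeRing)
import Algebra.Properties.Ring as RingProperties

module FieldArithmetic {q : ℕ} (𝔽 : FiniteField q) where
  open FiniteField 𝔽
  open IsCommutativeRing isCommutativeRing hiding (refl; sym; trans)
  open Inverse enumeration using (to)

  commutativeRing : CommutativeRing _ _
  commutativeRing = record { isCommutativeRing = isCommutativeRing }

  open RingProperties (CommutativeRing.ring commutativeRing) using (-1*x≈-x; -0#≈0#)
  open RingProperties (CommutativeRing.ring commutativeRing) public using (-‿injective)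

  infixr 8 _^_
  _^_ : F → ℕ → F
  _^_ = Defs._^_ 𝔽

  to-injective : ∀ {x y} → to x ≡ to y → x ≡ y
  to-injective = Injection.injective (Inverse⇒Injection enumeration)

  _≟_ : (x y : F) → Dec (x ≡ y)
  x ≟ y = map′ to-injective (cong to) (to x Fin.≟ to y)

  injection⇒q≤ : ∀ {k} (g : F → Fin k) → (∀ {x y} → g x ≡ g y → x ≡ y) → q ≤ k
  injection⇒q≤ g g-injective =
    Finₚ.injective⇒≤ (λ e → Injection.injective (Inverse⇒Injection (↔-sym enumeration)) (g-injective e))

  1≢0 : 1# ≢ 0#
  1≢0 1≡0 = 0≢1 (sym 1≡0)

  -1≢0 : - 1# ≢ 0#
  -1≢0 -1≡0 = 1≢0 (-‿injective (trans -1≡0 (sym -0#≈0#)))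

  -- Negation as multiplication by -1: the form a semiring normaliser can handle.
  -x≡-1*x : ∀ x → - x ≡ (- 1#) * x
  -x≡-1*x x = sym (-1*x≈-x x)

  x+-1*x≡0 : ∀ x → x + (- 1#) * x ≡ 0#
  x+-1*x≡0 x = trans (cong (x +_) (sym (-x≡-1*x x))) (-‿inverseʳ x)

  *-cancelˡ : ∀ {a b c} → a ≢ 0# → a * b ≡ a * c → b ≡ c
  *-cancelˡ {a} {b} {c} a≢0 ab≡ac with inverse a a≢0
  ... | a⁻¹ , aa⁻¹≡1 = begin
      b              ≡⟨ unscale b ⟩
      a⁻¹ * (a * b)  ≡⟨ cong (a⁻¹ *_) ab≡ac ⟩
      a⁻¹ * (a * c)  ≡⟨ sym (unscale c) ⟩
      c              ∎
    where
    open ≡-Reasoning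
    unscale : ∀ z → z ≡ a⁻¹ * (a * z)
    unscale z = begin
      z              ≡⟨ sym (*-identityˡ z) ⟩
      1# * z         ≡⟨ cong (_* z) (trans (sym aa⁻¹≡1) (*-comm a a⁻¹)) ⟩
      (a⁻¹ * a) * z  ≡⟨ *-assoc a⁻¹ a z ⟩
      a⁻¹ * (a * z)  ∎

  *-nonzero : ∀ {x y} → x ≢ 0# → y ≢ 0# → x * y ≢ 0#
  *-nonzero {x} x≢0 y≢0 xy≡0 = y≢0 (*-cancelˡ x≢0 (trans xy≡0 (sym (zeroʳ x))))

  ^-+ : ∀ x m n → x ^ (m ℕ.+ n) ≡ x ^ m * x ^ n
  ^-+ x zero    n = sym (*-identityˡ _)
  ^-+ x (suc m) n = trans (cong (x *_) (^-+ x m n)) (sym (*-assoc x _ _))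

  ^-double : ∀ x n → x ^ (2 ℕ.* n) ≡ x ^ n * x ^ n
  ^-double x n = trans (cong (λ k → x ^ (n ℕ.+ k)) (ℕₚ.+-identityʳ n)) (^-+ x n n)

  ^-nonzero : ∀ {x} → x ≢ 0# → ∀ n → x ^ n ≢ 0#
  ^-nonzero x≢0 zero    = 1≢0
  ^-nonzero x≢0 (suc n) = *-nonzero x≢0 (^-nonzero x≢0 n)

  ^-multiple : ∀ {x p} → x ^ p ≡ 1# → ∀ k → x ^ (k ℕ.* p) ≡ 1#
  ^-multiple x^p≡1 zero    = refl
  ^-multiple {x} {p} x^p≡1 (suc k) =
    trans (^-+ x p (k ℕ.* p)) (trans (cong₂ _*_ x^p≡1 (^-multiple x^p≡1 k)) (*-identityˡ 1#))

  ^-mod : ∀ {x} p .{{_ : ℕ.NonZero p}} → x ^ p ≡ 1# → ∀ n → x ^ n ≡ x ^ (n % p)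
  ^-mod {x} p x^p≡1 n = begin
    x ^ n                                ≡⟨ cong (x ^_) (m≡m%n+[m/n]*n n p) ⟩
    x ^ (n % p ℕ.+ (n / p) ℕ.* p)        ≡⟨ ^-+ x (n % p) _ ⟩
    x ^ (n % p) * x ^ ((n / p) ℕ.* p)    ≡⟨ cong (x ^ (n % p) *_) (^-multiple x^p≡1 (n / p)) ⟩
    x ^ (n % p) * 1#                     ≡⟨ *-identityʳ _ ⟩
    x ^ (n % p)                          ∎
    where open ≡-Reasoning

  ^-difference : ∀ {x i j} → x ≢ 0# → i ≤ j → x ^ i ≡ x ^ j → x ^ (j ∸ i) ≡ 1#
  ^-difference {x} {i} {j} x≢0 i≤j x^i≡x^j = sym (*-cancelˡ (^-nonzero x≢0 i) (begin
    x ^ i * 1#             ≡⟨ *-identityʳ _ ⟩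
    x ^ i                  ≡⟨ x^i≡x^j ⟩
    x ^ j                  ≡⟨ cong (x ^_) (sym (ℕₚ.m+[n∸m]≡n i≤j)) ⟩
    x ^ (i ℕ.+ (j ∸ i))    ≡⟨ ^-+ x i (j ∸ i) ⟩
    x ^ i * x ^ (j ∸ i)    ∎))
    where open ≡-Reasoning

module PrimitiveElement {q : ℕ} (𝔽 : FiniteField q) {ξ : FiniteField.F 𝔽} (prim : Primitive 𝔽 ξ) where
  open FiniteField 𝔽
  open IsCommutativeRing isCommutativeRing hiding (refl; sym; trans)
  open FieldArithmetic 𝔽
  open Inverse enumeration using (to)

  zeroOr : ∀ {k} → ((y : F) → y ≢ 0# → Fin k) → F → Fin (suc k)
  zeroOr c y with y ≟ 0#
  ... | yes _   = Fin.zero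
  ... | no y≢0  = Fin.suc (c y y≢0)

  zeroOr-injective : ∀ {k} (c : (y : F) → y ≢ 0# → Fin k) →
    (∀ {y z} (y≢0 : y ≢ 0#) (z≢0 : z ≢ 0#) → c y y≢0 ≡ c z z≢0 → y ≡ z) →
    ∀ {y z} → zeroOr c y ≡ zeroOr c z → y ≡ z
  zeroOr-injective c c-injective {y} {z} e with y ≟ 0# | z ≟ 0# | e
  ... | yes y≡0 | yes z≡0 | _  = trans y≡0 (sym z≡0)
  ... | no y≢0  | no z≢0  | e′ = c-injective y≢0 z≢0 (Finₚ.suc-injective e′)

  -- ξ ≠ 0 when q ≥ 3: otherwise every nonzero element is a power of 0, hence 1,
  -- and F = {0, 1}.
  primitive≢0 : 3 ≤ q → ξ ≢ 0#
  primitive≢0 3≤q ξ≡0 = ℕₚ.<⇒≱ 3≤q (injection⇒q≤ (zeroOr (λ _ _ → Fin.zero))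
      (zeroOr-injective _ (λ y≢0 z≢0 _ → trans (isOne y≢0) (sym (isOne z≢0)))))
    where
    isOne : ∀ {y} → y ≢ 0# → y ≡ 1#
    isOne {y} y≢0 with prim y y≢0
    ... | zero  , 1≡y   = sym 1≡y
    ... | suc d , ξ^d≡y = ⊥-elim (y≢0 (trans (sym ξ^d≡y) (trans (cong (_* ξ ^ d) ξ≡0) (zeroˡ (ξ ^ d)))))

  module _ {p : ℕ} (1≤p : 1 ≤ p) (ξ^p≡1 : ξ ^ p ≡ 1#) where
    private instance
      p≢0 : ℕ.NonZero p
      p≢0 = ℕ.>-nonZero 1≤p

    discreteLog : ∀ y → y ≢ 0# → ∃[ e ] (e < p × ξ ^ e ≡ y)
    discreteLog y y≢0 with prim y y≢0
    ... | d , ξ^d≡y = d % p , m%n<n d p , trans (sym (^-mod p ξ^p≡1 d)) ξ^d≡y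

    -- hence y ↦ its discrete logarithm embeds F into Fin (p + 1)
    periodBound : q ≤ suc p
    periodBound = injection⇒q≤ (zeroOr log) (zeroOr-injective log log-injective)
      where
      log : (y : F) → y ≢ 0# → Fin p
      log y y≢0 = fromℕ< (proj₁ (proj₂ (discreteLog y y≢0)))
      log-injective : ∀ {y z} (y≢0 : y ≢ 0#) (z≢0 : z ≢ 0#) → log y y≢0 ≡ log z z≢0 → y ≡ z
      log-injective {y} {z} y≢0 z≢0 same = begin
        y          ≡⟨ sym (proj₂ (proj₂ (discreteLog y y≢0))) ⟩
        ξ ^ e₁     ≡⟨ cong (ξ ^_) e₁≡e₂ ⟩
        ξ ^ e₂     ≡⟨ proj₂ (proj₂ (discreteLog z z≢0)) ⟩
        z          ∎
        where
        open ≡-Reasoning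
        e₁ = proj₁ (discreteLog y y≢0)
        e₂ = proj₁ (discreteLog z z≢0)
        e₁≡e₂ : e₁ ≡ e₂
        e₁≡e₂ = trans (sym (Finₚ.toℕ-fromℕ< _)) (trans (cong toℕ same) (Finₚ.toℕ-fromℕ< _))

  -- Pigeonhole: the q powers ξ^0, …, ξ^(q-1) are among the q - 1 nonzero elements.
  powerCollision : ξ ≢ 0# → ∀ {n} → q ≡ suc n → ∃₂ λ i j → i < j × j ≤ n × ξ ^ i ≡ ξ ^ j
  powerCollision ξ≢0 {n} refl
    with Finₚ.pigeonhole (ℕₚ.n<1+n n) (λ i → punchOut {i = to 0#} {j = to (ξ ^ toℕ i)}
                                        (λ e → ^-nonzero ξ≢0 (toℕ i) (sym (to-injective e))))
  ... | i , j , i<j , same =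
    toℕ i , toℕ j , i<j , ℕₚ.≤-pred (Finₚ.toℕ<n j) ,
    to-injective (Finₚ.punchOut-injective {i = to 0#} _ _ same)

  -- Fermat: ξ^(q-1) = 1; with periodBound, the order of ξ is exactly q - 1.
  fermat : 3 ≤ q → ξ ^ (q ∸ 1) ≡ 1#
  fermat 3≤q@(s≤s _) with powerCollision (primitive≢0 3≤q) refl
  ... | i , j , i<j , j≤n , ξ^i≡ξ^j = subst (λ k → ξ ^ k ≡ 1#) p≡n ξ^p≡1
    where
    ξ^p≡1 : ξ ^ (j ∸ i) ≡ 1#
    ξ^p≡1 = ^-difference (primitive≢0 3≤q) (ℕₚ.<⇒≤ i<j) ξ^i≡ξ^j
    p≡n : j ∸ i ≡ q ∸ 1
    p≡n = ℕₚ.≤-antisym (ℕₚ.≤-trans (ℕₚ.m∸n≤m j i) j≤n)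
                       (ℕₚ.≤-pred (periodBound (ℕₚ.m<n⇒0<n∸m i<j) ξ^p≡1))

module ExponentArithmetic where
  open import Data.Nat using (_+_; _*_)

  -- For q = 4a + 3 let h = 2a + 1: then 2h = q - 1, and J ≥ a says h ≤ 2J + 1.
  halfOrder : ∀ {q J} → q % 4 ≡ 3 → q ∸ 3 ≤ 4 * J → ∃[ h ] (1 ≤ h × h + h ≡ q ∸ 1 × h ≤ suc (J + J))
  halfOrder {q} {J} q%4≡3 q∸3≤4J = suc (a * 2) , s≤s z≤n , 2h≡q∸1 , s≤s 2a≤2J
    where
    a = q / 4
    q≡4a+3 : q ≡ 3 + a * 4
    q≡4a+3 = trans (m≡m%n+[m/n]*n q 4) (cong (_+ a * 4) q%4≡3)
    2h≡q∸1 : suc (a * 2) + suc (a * 2) ≡ q ∸ 1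
    2h≡q∸1 = trans (double a) (sym (cong (_∸ 1) q≡4a+3))
      where
      double : ∀ a → suc (a * 2) + suc (a * 2) ≡ 2 + a * 4
      double = solve-∀
    a≤J : a ≤ J
    a≤J = ℕₚ.*-cancelˡ-≤ 4 (subst (_≤ 4 * J) (trans (cong (_∸ 3) q≡4a+3) (ℕₚ.*-comm a 4)) q∸3≤4J)
    2a≤2J : a * 2 ≤ J + J
    2a≤2J = subst (a * 2 ≤_) (twice J) (ℕₚ.*-monoˡ-≤ 2 a≤J)
      where
      twice : ∀ J → J * 2 ≡ J + J
      twice = solve-∀

  doubleJBounds : ∀ {q J} → 27 ≤ q → q ∸ 3 ≤ 4 * J → 2 * J ≤ q ∸ 3 → 1 ≤ 2 * J × suc (2 * J) < q
  doubleJBounds {q} {zero} 27≤q q∸3≤0 _ with ℕₚ.≤-trans (ℕₚ.∸-monoˡ-≤ 3 27≤q) q∸3≤0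
  ... | ()
  doubleJBounds {q} {suc J} 27≤q _ 2J≤q∸3 = s≤s z≤n , 2J+2≤q
    where
    2J+3≤q : 2 * suc J + 3 ≤ q
    2J+3≤q = ℕₚ.m≤o∸n⇒m+n≤o (2 * suc J) (ℕₚ.≤-trans (s≤s (s≤s (s≤s z≤n))) 27≤q) 2J≤q∸3
    2J+2≤q : suc (suc (2 * suc J)) ≤ q
    2J+2≤q = ℕₚ.≤-trans (ℕₚ.n≤1+n _) (subst (_≤ q) (ℕₚ.+-comm (2 * suc J) 3) 2J+3≤q)

  -- The exponent case split behind the three kinds of bisecants.
  exponentCases : ∀ {h J e} → h ≤ suc (J + J) → J < e → e ≤ h + h →
    (∃[ d ] (d ≤ J × d + e ≡ J + J)) ⊎ (∃[ d ] (d ≤ J × d + e ≡ h + h)) ⊎ (∃[ d ] (d ≤ J × d + h ≡ e))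
  exponentCases {h} {J} {e} h≤2J+1 J<e e≤2h with e ℕ.≤? J + J | h + h ℕ.≤? e + J
  ... | yes e≤2J | _ =
    inj₁ (J + J ∸ e , ℕₚ.m≤n+o⇒m∸n≤o (J + J) e (ℕₚ.+-monoˡ-≤ J (ℕₚ.<⇒≤ J<e)) , ℕₚ.m∸n+n≡m e≤2J)
  ... | no _ | yes 2h≤e+J =
    inj₂ (inj₁ (h + h ∸ e , ℕₚ.m≤n+o⇒m∸n≤o (h + h) e 2h≤e+J , ℕₚ.m∸n+n≡m e≤2h))
  ... | no e≰2J | no 2h≰e+J =
    inj₂ (inj₂ (e ∸ h , ℕₚ.m≤n+o⇒m∸n≤o e h e≤h+J , ℕₚ.m∸n+n≡m h≤e))
    where
    h≤e : h ≤ e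
    h≤e = ℕₚ.≤-trans h≤2J+1 (ℕₚ.≰⇒> e≰2J)
    -- e + J < 2h ≤ h + 2J + 1
    e≤h+J : e ≤ h + J
    e≤h+J = ℕₚ.+-cancelʳ-≤ J e (h + J) (ℕₚ.≤-pred (ℕₚ.≤-trans (ℕₚ.≰⇒> 2h≰e+J)
              (subst (h + h ≤_) (regroup h J) (ℕₚ.+-monoʳ-≤ h h≤2J+1))))
      where
      regroup : ∀ h J → h + suc (J + J) ≡ suc (h + J + J)
      regroup = solve-∀

module ConicGeometry {q : ℕ} (𝔽 : FiniteField q) where
  open FiniteField 𝔽
  open IsCommutativeRing isCommutativeRing hiding (refl; sym; trans)
  open FieldArithmetic 𝔽
  open import Algebra.Solver.Ring.NaturalCoefficients.Default
    (CommutativeRing.commutativeSemiring commutativeRing) using (solve; _:=_; _:+_; _:*_; con)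

  Point : Set
  Point = Triple 𝔽

  conicPoint : F → Point
  conicPoint t = ⟨ 1# , t , t * t ⟩

  axisPoint : F → Point
  axisPoint c = ⟨ 1# , 0# , - c ⟩

  P : Point
  P = ⟨ 0# , 1# , 0# ⟩

  ⟨⟩-cong : ∀ {a b c a′ b′ c′} → a ≡ a′ → b ≡ b′ → c ≡ c′ → _≡_ {A = Point} ⟨ a , b , c ⟩ ⟨ a′ , b′ , c′ ⟩
  ⟨⟩-cong refl refl refl = refl

  scale-one : ∀ X → scale 𝔽 1# X ≡ X
  scale-one ⟨ a , b , c ⟩ = ⟨⟩-cong (*-identityˡ a) (*-identityˡ b) (*-identityˡ c)

  ∼-refl : ∀ X → _∼_ 𝔽 X X
  ∼-refl X = 1# , 1≢0 , sym (scale-one X)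

  incident-scale : ∀ L x X → Incident 𝔽 L X → Incident 𝔽 L (scale 𝔽 x X)
  incident-scale ⟨ a , b , c ⟩ x ⟨ u , v , w ⟩ LX = begin
    a * (x * u) + b * (x * v) + c * (x * w)  ≡⟨ factor a b c x u v w ⟩
    x * (a * u + b * v + c * w)              ≡⟨ cong (x *_) LX ⟩
    x * 0#                                   ≡⟨ zeroʳ x ⟩
    0#                                       ∎
    where
    open ≡-Reasoning
    factor : ∀ a b c x u v w → a * (x * u) + b * (x * v) + c * (x * w) ≡ x * (a * u + b * v + c * w)
    factor = solve 7 (λ a b c x u v w → a :* (x :* u) :+ b :* (x :* v) :+ c :* (x :* w)
                                     := x :* (a :* u :+ b :* v :+ c :* w)) refl

  bisecant-scale : ∀ S x X → OnBisecant 𝔽 S X → OnBisecant 𝔽 S (scale 𝔽 x X)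
  bisecant-scale S x X (Y , Y′ , L , SY , SY′ , Y≁Y′ , L≢0 , LY , LY′ , LX) =
    Y , Y′ , L , SY , SY′ , Y≁Y′ , L≢0 , LY , LY′ , incident-scale L x X LX

  conic-x0≢0 : ∀ {x y z} → y * y ≡ x * z → y ≢ 0# → x ≢ 0#
  conic-x0≢0 {x} {y} {z} y²≡xz y≢0 x≡0 = *-nonzero y≢0 y≢0 (trans y²≡xz (trans (cong (_* z) x≡0) (zeroˡ z)))

  -- A conic point off ℓ1 is a nonzero multiple of (1, t, t²), t = x1/x0 ≠ 0.
  conic-parametrisation : ∀ X → OnConic 𝔽 X → ¬ OnL1 𝔽 X →
    ∃₂ λ x t → x ≢ 0# × t ≢ 0# × X ≡ scale 𝔽 x (conicPoint t)
  conic-parametrisation ⟨ x , y , z ⟩ y²≡xz y≢0 with inverse x (conic-x0≢0 y²≡xz y≢0)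
  ... | x⁻¹ , xx⁻¹≡1 =
    x , t , conic-x0≢0 y²≡xz y≢0 , t≢0 , ⟨⟩-cong (sym (*-identityʳ x)) (sym xt≡y) (sym xt²≡z)
    where
    open ≡-Reasoning
    t = y * x⁻¹
    swap : ∀ a b c → a * (b * c) ≡ b * (a * c)
    swap = solve 3 (λ a b c → a :* (b :* c) := b :* (a :* c)) refl
    xt≡y : x * t ≡ y
    xt≡y = begin
      x * (y * x⁻¹)   ≡⟨ swap x y x⁻¹ ⟩
      y * (x * x⁻¹)   ≡⟨ cong (y *_) xx⁻¹≡1 ⟩
      y * 1#          ≡⟨ *-identityʳ y ⟩
      y               ∎
    xt²≡z : x * (t * t) ≡ z
    xt²≡z = begin
      x * (t * t)       ≡⟨ sym (*-assoc x t t) ⟩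
      (x * t) * t       ≡⟨ cong (_* t) xt≡y ⟩
      y * (y * x⁻¹)     ≡⟨ sym (*-assoc y y x⁻¹) ⟩
      (y * y) * x⁻¹     ≡⟨ cong (_* x⁻¹) y²≡xz ⟩
      (x * z) * x⁻¹     ≡⟨ trans (*-assoc x z x⁻¹) (swap x z x⁻¹) ⟩
      z * (x * x⁻¹)     ≡⟨ cong (z *_) xx⁻¹≡1 ⟩
      z * 1#            ≡⟨ *-identityʳ z ⟩
      z                 ∎
    t≢0 : t ≢ 0#
    t≢0 t≡0 = y≢0 (trans (sym xt≡y) (trans (cong (x *_) t≡0) (zeroʳ x)))

  chord : F → F → Point
  chord s t = ⟨ s * t , (- 1#) * (s + t) , 1# ⟩

  chord-left : ∀ s t → Incident 𝔽 (chord s t) (conicPoint s)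
  chord-left s t = trans (expand (- 1#) s t) (x+-1*x≡0 _)
    where
    expand : ∀ n s t → s * t * 1# + n * (s + t) * s + 1# * (s * s) ≡ (s * t + s * s) + n * (s * t + s * s)
    expand = solve 3 (λ n s t → s :* t :* con 1 :+ n :* (s :+ t) :* s :+ con 1 :* (s :* s)
                             := (s :* t :+ s :* s) :+ n :* (s :* t :+ s :* s)) refl

  chord-right : ∀ s t → Incident 𝔽 (chord s t) (conicPoint t)
  chord-right s t = trans (expand (- 1#) s t) (x+-1*x≡0 _)
    where
    expand : ∀ n s t → s * t * 1# + n * (s + t) * t + 1# * (t * t) ≡ (s * t + t * t) + n * (s * t + t * t)
    expand = solve 3 (λ n s t → s :* t :* con 1 :+ n :* (s :+ t) :* t :+ con 1 :* (t :* t)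
                             := (s :* t :+ t :* t) :+ n :* (s :* t :+ t :* t)) refl

  chord-axis : ∀ s t → Incident 𝔽 (chord s t) (axisPoint (s * t))
  chord-axis s t = trans (cong (λ w → s * t * 1# + (- 1#) * (s + t) * 0# + 1# * w) (-x≡-1*x (s * t)))
                         (trans (expand (- 1#) s t) (x+-1*x≡0 _))
    where
    expand : ∀ n s t → s * t * 1# + n * (s + t) * 0# + 1# * (n * (s * t)) ≡ s * t + n * (s * t)
    expand = solve 3 (λ n s t → s :* t :* con 1 :+ n :* (s :+ t) :* con 0 :+ con 1 :* (n :* (s :* t))
                             := s :* t :+ n :* (s :* t)) refl

  chordThroughP : F → Point
  chordThroughP s = ⟨ s * s , 0# , - 1# ⟩

  chordThroughP-conic : ∀ s t → s * s ≡ t * t → Incident 𝔽 (chordThroughP s) (conicPoint t)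
  chordThroughP-conic s t s²≡t² = trans (expand (- 1#) s t) (trans (cong (λ w → s * s + (- 1#) * w) (sym s²≡t²)) (x+-1*x≡0 _))
    where
    expand : ∀ n s t → s * s * 1# + 0# * t + n * (t * t) ≡ s * s + n * (t * t)
    expand = solve 3 (λ n s t → s :* s :* con 1 :+ con 0 :* t :+ n :* (t :* t) := s :* s :+ n :* (t :* t)) refl

  chordThroughP-P : ∀ s → Incident 𝔽 (chordThroughP s) P
  chordThroughP-P s = expand (- 1#) s
    where
    expand : ∀ n s → s * s * 0# + 0# * 1# + n * 0# ≡ 0#
    expand = solve 2 (λ n s → s :* s :* con 0 :+ con 0 :* con 1 :+ n :* con 0 := con 0) refl

  ℓ1 : Point
  ℓ1 = ⟨ 0# , 1# , 0# ⟩

  ℓ1-incident : ∀ X → OnL1 𝔽 X → Incident 𝔽 ℓ1 X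
  ℓ1-incident ⟨ x , y , z ⟩ y≡0 = trans (expand x y z) y≡0
    where
    expand : ∀ x y z → 0# * x + 1# * y + 0# * z ≡ y
    expand = solve 3 (λ x y z → con 0 :* x :+ con 1 :* y :+ con 0 :* z := y) refl

  module _ (S : Point → Set) where

    bisecant-via-axis : ∀ {s t c} → S (conicPoint s) → S (axisPoint c) → s ≢ 0# → s * t ≡ c →
      OnBisecant 𝔽 S (conicPoint t)
    bisecant-via-axis {s} {t} Ss Sc s≢0 refl =
      conicPoint s , axisPoint (s * t) , chord s t , Ss , Sc , distinct , (λ (_ , _ , 1≡0) → 1≢0 1≡0) ,
      chord-left s t , chord-axis s t , chord-right s t
      where
      distinct : ¬ (_∼_ 𝔽 (conicPoint s) (axisPoint (s * t)))
      distinct (λ′ , _ , e) = s≢0 (trans (cong Triple.c1 e) (zeroʳ λ′))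

    bisecant-via-P : ∀ {s t} → S (conicPoint s) → S P → s * s ≡ t * t → OnBisecant 𝔽 S (conicPoint t)
    bisecant-via-P {s} {t} Ss SP s²≡t² =
      conicPoint s , P , chordThroughP s , Ss , SP , distinct , (λ (_ , _ , -1≡0) → -1≢0 -1≡0) ,
      chordThroughP-conic s s refl , chordThroughP-P s , chordThroughP-conic s t s²≡t²
      where
      distinct : ¬ (_∼_ 𝔽 (conicPoint s) P)
      distinct (λ′ , _ , e) = 1≢0 (trans (cong Triple.c0 e) (zeroʳ λ′))

    bisecant-ℓ1 : ∀ {a b} → S (axisPoint a) → S (axisPoint b) → a ≢ b → ∀ X → OnL1 𝔽 X → OnBisecant 𝔽 S X
    bisecant-ℓ1 {a} {b} Sa Sb a≢b X onℓ1 =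
      axisPoint a , axisPoint b , ℓ1 , Sa , Sb , distinct , (λ (_ , 1≡0 , _) → 1≢0 1≡0) ,
      ℓ1-incident (axisPoint a) refl , ℓ1-incident (axisPoint b) refl , ℓ1-incident X onℓ1
      where
      distinct : ¬ (_∼_ 𝔽 (axisPoint a) (axisPoint b))
      distinct (λ′ , _ , e) = a≢b (-‿injective (begin
        - a           ≡⟨ cong Triple.c2 e ⟩
        λ′ * - b      ≡⟨ cong (_* - b) λ′≡1 ⟩
        1# * - b      ≡⟨ *-identityˡ (- b) ⟩
        - b           ∎))
        where
        open ≡-Reasoning
        λ′≡1 : λ′ ≡ 1#
        λ′≡1 = trans (sym (*-identityʳ λ′)) (sym (cong Triple.c0 e))

module Covering {q : ℕ} (𝔽 : FiniteField q) where
  open FiniteField 𝔽 using (F; _*_; 0#; 1#; isCommutativeRing)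
  open IsCommutativeRing isCommutativeRing using (*-identityʳ)
  open FieldArithmetic 𝔽
  open ConicGeometry 𝔽
  open ExponentArithmetic
  open import Data.Nat using (_+_)

  module _ {ξ : F} (prim : Primitive 𝔽 ξ) (J : ℕ) (ξ≢0 : ξ ≢ 0#)
           {h : ℕ} (1≤h : 1 ≤ h) (ξ^2h≡1 : ξ ^ (h + h) ≡ 1#) (h≤2J+1 : h ≤ suc (J + J))
           (ξ^2J≢1 : ξ ^ (2 ℕ.* J) ≢ 1#) where
    open PrimitiveElement 𝔽 prim using (discreteLog)

    E : Point → Set
    E = InE 𝔽 ξ J

    inD : ∀ {d x X} → d ≤ J → x ≢ 0# → X ≡ scale 𝔽 x (conicPoint (ξ ^ d)) → InD 𝔽 ξ J X
    inD {d} {x} d≤J x≢0 refl = d , d≤J , x , x≢0 , cong (λ w → scale 𝔽 x ⟨ 1# , ξ ^ d , w ⟩) (sym (^-double ξ d))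

    D⊆E : ∀ {d} → d ≤ J → E (conicPoint (ξ ^ d))
    D⊆E d≤J = inj₁ (inD d≤J 1≢0 (sym (scale-one _)))

    P∈E : E P
    P∈E = inj₂ (inj₁ (∼-refl P))

    Z∈E : E (axisPoint 1#)
    Z∈E = inj₂ (inj₂ (inj₁ (∼-refl _)))

    B∈E : E (axisPoint (ξ ^ (2 ℕ.* J)))
    B∈E = inj₂ (inj₂ (inj₂ (∼-refl _)))

    conicPower-bisecant : ∀ {e} → J < e → e ≤ h + h → OnBisecant 𝔽 E (conicPoint (ξ ^ e))
    conicPower-bisecant {e} J<e e≤2h with exponentCases h≤2J+1 J<e e≤2h
    ... | inj₁ (d , d≤J , d+e≡2J) =
      bisecant-via-axis E (D⊆E d≤J) B∈E (^-nonzero ξ≢0 d)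
        (trans (sym (^-+ ξ d e)) (cong (ξ ^_) (trans d+e≡2J (cong (J +_) (sym (ℕₚ.+-identityʳ J))))))
    ... | inj₂ (inj₁ (d , d≤J , d+e≡2h)) =
      bisecant-via-axis E (D⊆E d≤J) Z∈E (^-nonzero ξ≢0 d)
        (trans (sym (^-+ ξ d e)) (trans (cong (ξ ^_) d+e≡2h) ξ^2h≡1))
    ... | inj₂ (inj₂ (d , d≤J , d+h≡e)) = bisecant-via-P E (D⊆E d≤J) P∈E squares
      where
      open ≡-Reasoning
      exponents : ∀ d h → (d + d) + (h + h) ≡ (d + h) + (d + h)
      exponents = solve-∀
      squares : ξ ^ d * ξ ^ d ≡ ξ ^ e * ξ ^ e
      squares = begin
        ξ ^ d * ξ ^ d                   ≡⟨ sym (^-+ ξ d d) ⟩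
        ξ ^ (d + d)                     ≡⟨ sym (*-identityʳ _) ⟩
        ξ ^ (d + d) * 1#                ≡⟨ cong (ξ ^ (d + d) *_) (sym ξ^2h≡1) ⟩
        ξ ^ (d + d) * ξ ^ (h + h)       ≡⟨ sym (^-+ ξ (d + d) (h + h)) ⟩
        ξ ^ ((d + d) + (h + h))         ≡⟨ cong (ξ ^_) (trans (exponents d h) (cong₂ _+_ d+h≡e d+h≡e)) ⟩
        ξ ^ (e + e)                     ≡⟨ ^-+ ξ e e ⟩
        ξ ^ e * ξ ^ e                   ∎

    powerMultiple-bisecant : ∀ {x e X} → x ≢ 0# → X ≡ scale 𝔽 x (conicPoint (ξ ^ e)) → e < h + h →
      ¬ InD 𝔽 ξ J X → OnBisecant 𝔽 E X
    powerMultiple-bisecant {x} {e} x≢0 refl e<2h X∉D with e ℕ.≤? J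
    ... | yes e≤J = ⊥-elim (X∉D (inD e≤J x≢0 refl))
    ... | no e≰J  = bisecant-scale E x _ (conicPower-bisecant (ℕₚ.≰⇒> e≰J) (ℕₚ.<⇒≤ e<2h))

    conic-bisecant : ∀ X → OnConic 𝔽 X → ¬ OnL1 𝔽 X → ¬ InD 𝔽 ξ J X → OnBisecant 𝔽 E X
    conic-bisecant X onC off X∉D =
      let (x , t , x≢0 , t≢0 , X≡xT) = conic-parametrisation X onC off
          (e , e<2h , ξ^e≡t)         = discreteLog (ℕₚ.≤-trans 1≤h (ℕₚ.m≤m+n h h)) ξ^2h≡1 t t≢0
      in powerMultiple-bisecant x≢0 (subst (λ s → X ≡ scale 𝔽 x (conicPoint s)) (sym ξ^e≡t) X≡xT) e<2h X∉D

    covering : ∀ X → OnL1 𝔽 X ⊎ (OnConic 𝔽 X × ¬ InD 𝔽 ξ J X) → OnBisecant 𝔽 E X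
    covering X (inj₁ onℓ1) = bisecant-ℓ1 E Z∈E B∈E (λ 1≡ξ^2J → ξ^2J≢1 (sym 1≡ξ^2J)) X onℓ1
    covering X (inj₂ (onC , X∉D)) with Triple.c1 X ≟ 0#
    ... | yes onℓ1 = covering X (inj₁ onℓ1)
    ... | no off   = conic-bisecant X onC off X∉D

-- Multiplication of ℕ, as written in the statement (above, * is the field's).
open import Data.Nat using (_*_)

theorem20 : (q : ℕ) → 27 ≤ q → IsPrimePower q → q % 4 ≡ 3 →
    (𝔽 : FiniteField q) → (ξ : FiniteField.F 𝔽) → Primitive 𝔽 ξ →
    (J : ℕ) → q ∸ 3 ≤ 4 * J → 2 * J ≤ q ∸ 3 →
    (X : Triple 𝔽) → NonZeroT 𝔽 X →
    OnL1 𝔽 X ⊎ (OnConic 𝔽 X × ¬ InD 𝔽 ξ J X) →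
    OnBisecant 𝔽 (InE 𝔽 ξ J) X
theorem20 q 27≤q _ q%4≡3 𝔽 ξ prim J lower upper X _ X∈ℓ1∪C∖D
  with ExponentArithmetic.halfOrder {q} {J} q%4≡3 lower
     | ExponentArithmetic.doubleJBounds {q} {J} 27≤q lower upper
... | h , 1≤h , 2h≡q∸1 , h≤2J+1 | 1≤2J , 2J+1<q =
  Covering.covering 𝔽 prim J (primitive≢0 3≤q) 1≤h ξ^2h≡1 h≤2J+1 ξ^2J≢1 X X∈ℓ1∪C∖D
  where
  open FiniteField 𝔽 using (1#)
  open FieldArithmetic 𝔽 using (_^_)
  open PrimitiveElement 𝔽 prim using (primitive≢0; fermat; periodBound)
  3≤q : 3 ≤ q
  3≤q = ℕₚ.≤-trans (s≤s (s≤s (s≤s z≤n))) 27≤q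
  ξ^2h≡1 : ξ ^ (h ℕ.+ h) ≡ 1#
  ξ^2h≡1 = subst (λ n → ξ ^ n ≡ 1#) (sym 2h≡q∸1) (fermat 3≤q)
  ξ^2J≢1 : ξ ^ (2 * J) ≢ 1#
  ξ^2J≢1 ξ^2J≡1 = ℕₚ.<⇒≱ 2J+1<q (periodBound 1≤2J ξ^2J≡1)
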